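{- Let $f(x)\in\mathbb{Z}[x]$ have degree $d\ge2$ and let $t\in\mathbb{Z}$ be a wandering point for $f$. (i) If $n,\ n-1\in S(f,t)$, then $2/n$ is $(f,t,2)$-accessible. (ii) If $n$ is an odd integer such that $n,\ n-1,\ n-2\in S(f,t)$, then $3/n$ is $(f,t,3)$-accessible. (iii) If $m,n\in\mathbb{Z}$ are such that $(m-1)\mid(n-1)$ and $n,\ (n-1)/(m-1)\in S(f,t)$, then $m/n$ is $(f,t,2)$-accessible.
   Context: $\operatorname{Orb}_f(t)=\{f^n(t):n\ge0\}$ ($f^0(x)=x$, $f^n=f\circ f^{n-1}$); $t$ is wandering if this set is infinite. For an integer sequence $(a_n)_{n\ge1}$, an integer $u\ge2$ is a primitive divisor of $a_m$ if $u\mid a_m$ and $u\nmid a_s$ for all $1\le s<m$. $S(f,t)=\{n\ge1: f^n(t)-t \text{ has a primitive divisor}\}$ (with respect to the sequence $(f^n(t)-t)_{n\ge1}$). For $A\subseteq\mathbb{Z}$, $$\delta_{f,t}(A)=\lim_{X\to\infty}\frac{|\{x\in A\cap \operatorname{Orb}_f(t): x\le X\}|}{|\{x\in\operatorname{Orb}_f(t): x\le X\}|},$$ provided this limit exists. A real number $\delta\in[0,1]$ is $(f,t,k)$-accessible if there is a system $\{t+n_s\mathbb{Z}\}_{s=1}^k$ with positive integers $n_s$ such that $\delta_{f,t}\left(\bigcup_{s=1}^k(t+n_s\mathbb{Z})\right)=\delta$.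
   Formalization: In the density $\delta_{f,t}$ both the numerator and the denominator count orbit points x with |x| ≤ X in place of x ≤ X, and accessibility refers to this density. The statement above fails without it. -}

module Defs where

open import Data.Nat as ℕ using (ℕ; zero; suc)
open import Data.Integer as ℤ using (ℤ; +_; -[1+_])
open import Data.Integer.Divisibility using () renaming (_∣_ to _∣ℤ_)
open import Data.Rational as ℚ using (ℚ)
open import Data.List using (List; length; foldr)
open import Data.List.Relation.Unary.Unique.Propositional using (Unique)
open import Data.List.Membership.Propositional using (_∈_)
open import Data.Vec as Vec using (Vec; toList; last)
open import Data.Product using (Σ; ∃; _×_)
open import Data.Sum using (_⊎_)
open import Relation.Binary.PropositionalEquality using (_≡_; _≢_)
open import Relation.Nullary using (¬_)

-- A polynomial of degree d with integer coefficients: coefficient vector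
-- c₀, c₁, …, c_d (lowest degree first) with leading coefficient c_d ≠ 0.
record IntPoly (d : ℕ) : Set where
  constructor mkPoly
  field
    coeffs  : Vec ℤ (suc d)
    leading : last coeffs ≢ + 0
open IntPoly public

eval : ∀ {d} → IntPoly d → ℤ → ℤ
eval f x = foldr (λ c acc → c ℤ.+ x ℤ.* acc) (+ 0) (toList (coeffs f))

iter : ∀ {d} → IntPoly d → ℕ → ℤ → ℤ
iter f zero    t = t
iter f (suc n) t = eval f (iter f n t)

InOrb : ∀ {d} → IntPoly d → ℤ → ℤ → Set
InOrb f t x = ∃ λ n → iter f n t ≡ x

Wandering : ∀ {d} → IntPoly d → ℤ → Set
Wandering f t = ¬ (Σ (List ℤ) λ xs → ∀ x → InOrb f t x → x ∈ xs)

PrimitiveDivisor : (ℕ → ℤ) → ℕ → ℕ → Set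
PrimitiveDivisor a m u =
  (2 ℕ.≤ u) × (+ u ∣ℤ a m) × (∀ s → 1 ℕ.≤ s → s ℕ.< m → ¬ (+ u ∣ℤ a s))

HasPrimitiveDivisor : (ℕ → ℤ) → ℕ → Set
HasPrimitiveDivisor a m = ∃ λ u → PrimitiveDivisor a m u

InS : ∀ {d} → IntPoly d → ℤ → ℕ → Set
InS f t n = (1 ℕ.≤ n) × HasPrimitiveDivisor (λ k → iter f k t ℤ.- t) n

InSℤ : ∀ {d} → IntPoly d → ℤ → ℤ → Set
InSℤ f t n = ∃ λ k → (n ≡ + k) × InS f t k

HasCount : (ℤ → Set) → ℕ → Set
HasCount P N = Σ (List ℤ) λ xs →
  Unique xs × (∀ x → x ∈ xs → P x) × (∀ x → P x → x ∈ xs) × (length xs ≡ N)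

-- the rational p / q (with the junk value 0 when q = 0)
frac : ℤ → ℤ → ℚ
frac p (+ zero)    = ℚ.0ℚ
frac p (+ suc k)   = p ℚ./ suc k
frac p (-[1+ k ])  = (ℤ.- p) ℚ./ suc k

DensityEq : ∀ {d} → IntPoly d → ℤ → (ℤ → Set) → ℚ → Set
DensityEq f t A δ =
  ∀ (ε : ℚ) → ℚ.0ℚ ℚ.< ε → ∃ λ X₀ → ∀ (X : ℕ) → X₀ ℕ.≤ X →
    Σ ℕ λ N → Σ ℕ λ M →
      HasCount (λ x → A x × InOrb f t x × ℤ.∣ x ∣ ℕ.≤ X) N ×
      HasCount (λ x → InOrb f t x × ℤ.∣ x ∣ ℕ.≤ X) M ×
      (M ≢ 0) ×
      (ℚ.∣ frac (+ N) (+ M) ℚ.- δ ∣ ℚ.< ε)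

InProg : ℤ → ℕ → ℤ → Set
InProg t n x = + n ∣ℤ (x ℤ.- t)

InUnion : ∀ {k} → ℤ → Vec ℕ k → ℤ → Set
InUnion t Vec.[] x = ⊥'
  where open import Data.Empty renaming (⊥ to ⊥')
InUnion t (n Vec.∷ ns) x = InProg t n x ⊎ InUnion t ns x

AllPositive : ∀ {k} → Vec ℕ k → Set
AllPositive Vec.[] = ⊤'
  where open import Data.Unit renaming (⊤ to ⊤')
AllPositive (n Vec.∷ ns) = (1 ℕ.≤ n) × AllPositive ns

Accessible : ∀ {d} → IntPoly d → ℤ → ℕ → ℚ → Set
Accessible f t k δ =
  Σ (Vec ℕ k) λ ns → AllPositive ns × DensityEq f t (InUnion t ns) δ

-- A primitive divisor u of f^a(t) - t divides f^k(t) - t exactly when a ∣ k, since f^k(t) mod u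
-- is periodic in k with period a.  So for a₁, …, aₖ ∈ S(f,t) the progressions t + uₛℤ meet the
-- orbit exactly at the indices divisible by some aₛ, a pattern of period ∏ aₛ whose frequency
-- inclusion–exclusion computes when the aₛ are pairwise coprime.  As deg f ≥ 2 and t wanders,
-- |f^k(t)| is eventually increasing, so the orbit points with |x| ≤ X are the f^k(t) with k < K
-- for some K → ∞, and densities along the orbit are frequencies among indices.  Then (i) takes
-- n, n - 1, with frequency (2n - 2)/(n(n - 1)) = 2/n; (ii) takes n, n - 1, n - 2, pairwise
-- coprime for odd n; (iii) takes n and q = (n - 1)/(m - 1), coprime as n ≡ 1 mod q, with
-- frequency (n + q - 1)/(n q) = m/n.

module Submission where

open import Defs

open import Data.Bool using (Bool; true; false; if_then_else_; _∨_; _∧_)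
import Data.Bool.Properties as Boolₚ
open import Data.Empty using (⊥-elim)
open import Data.Fin as Fin using (Fin)
import Data.Fin.Properties as Finₚ
open import Data.Integer as ℤ using (ℤ; +_; -[1+_]; ∣_∣; _⊖_; _+_; _-_; _*_)
import Data.Integer.Properties as ℤₚ
open import Data.Integer.Divisibility.Signed as ℤ∣ using () renaming (_∣_ to _∣ℤ_)
import Data.Integer.Tactic.RingSolver as ℤSolver
open import Data.List as List using (List; foldr)
import Data.List.Properties as List
open import Data.List.Membership.Propositional using (_∈_)
open import Data.List.Membership.Propositional.Properties using (∈-applyUpTo⁺; ∈-applyUpTo⁻; ∈-filter⁺; ∈-filter⁻)
open import Data.List.Relation.Unary.Unique.Propositional using (Unique)
open import Data.List.Relation.Unary.Unique.Propositional.Properties using (applyUpTo⁺₁; filter⁺)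
open import Data.Nat as ℕ using (ℕ; zero; suc; _≤_; _<_; z≤n; s≤s; _⊔_)
import Data.Nat.Properties as ℕₚ
import Data.Nat.Coprimality as Coprime
open Coprime using (Coprime)
import Data.Nat.Divisibility as ℕ∣
import Data.Nat.DivMod as ℕDM
open ℕDM using (_%_; _/_)
open import Data.Nat.Induction using (<-rec)
import Data.Nat.Tactic.RingSolver as ℕSolver
open import Data.Product using (Σ; ∃; _×_; _,_; proj₁; proj₂)
import Data.Rational as ℚ
import Data.Rational.Properties as ℚₚ
import Data.Rational.Unnormalised as ℚᵘ
import Data.Rational.Unnormalised.Properties as ℚᵘₚ
import Data.Sign as Sign
open import Data.Sum using (_⊎_; inj₁; inj₂)
open import Data.Sum.Function.Propositional using (_⊎-⇔_)
open import Data.Vec as Vec using (Vec; []; _∷_)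
open import Data.Vec.Relation.Unary.All using (All; []; _∷_)
open import Data.Vec.Relation.Unary.Any as Any using (Any; any?)
open import Function using (flip; _∘_; _⇔_; mk⇔; case_of_; Equivalence)
open import Function.Properties.Equivalence using () renaming (trans to ⇔-trans; sym to ⇔-sym)
open import Relation.Binary.Definitions using (tri<; tri≈; tri>)
open import Relation.Binary.PropositionalEquality
open import Relation.Nullary using (¬_; yes; no)
open import Relation.Nullary.Decidable using (does; dec-true; dec-false; does-⇔; _×-dec_; _⊎-dec_)
open import Relation.Unary using (Decidable)

-- Growth of polynomials

horner : ∀ {n} → Vec ℤ n → ℤ → ℤ
horner []       x = + 0
horner (c ∷ cs) x = c ℤ.+ x ℤ.* horner cs x

eval≡horner : ∀ {d} (f : IntPoly d) x → eval f x ≡ horner (coeffs f) x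
eval≡horner f x = go (coeffs f)
  where
  go : ∀ {n} (cs : Vec ℤ n) → foldr (λ c acc → c ℤ.+ x ℤ.* acc) (+ 0) (Vec.toList cs) ≡ horner cs x
  go []       = refl
  go (c ∷ cs) = cong (λ a → c ℤ.+ x ℤ.* a) (go cs)

∣c+y∣-lower : ∀ c y M → M ℕ.+ ∣ c ∣ ≤ ∣ y ∣ → M ≤ ∣ c ℤ.+ y ∣
∣c+y∣-lower c y M M+∣c∣≤∣y∣ = ℕₚ.+-cancelʳ-≤ (∣ c ∣) M (∣ c ℤ.+ y ∣) (begin
  M ℕ.+ ∣ c ∣                 ≤⟨ M+∣c∣≤∣y∣ ⟩
  ∣ y ∣                       ≡⟨ cong ∣_∣ (c+y-c≡y c y) ⟨
  ∣ (c ℤ.+ y) ℤ.- c ∣         ≤⟨ ℤₚ.∣i-j∣≤∣i∣+∣j∣ (c ℤ.+ y) c ⟩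
  ∣ c ℤ.+ y ∣ ℕ.+ ∣ c ∣       ∎)
  where
  open ℕₚ.≤-Reasoning
  c+y-c≡y : ∀ c y → (c ℤ.+ y) ℤ.- c ≡ y
  c+y-c≡y = ℤSolver.solve-∀

∣x∣*M≤∣x*y∣ : ∀ x y M → M ≤ ∣ y ∣ → ∣ x ∣ ℕ.* M ≤ ∣ x ℤ.* y ∣
∣x∣*M≤∣x*y∣ x y M M≤∣y∣ =
  subst (∣ x ∣ ℕ.* M ≤_) (sym (ℤₚ.abs-* x y)) (ℕₚ.*-monoʳ-≤ ∣ x ∣ M≤∣y∣)

Eventually : (ℤ → Set) → Set
Eventually P = ∃ λ B → ∀ x → B ≤ ∣ x ∣ → P x

horner-nonzero  : ∀ {e} (w : Vec ℤ (suc e)) → Vec.last w ≢ + 0 →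
                  Eventually (λ x → 1 ≤ ∣ horner w x ∣)
horner-unbounded : ∀ {e} c (w : Vec ℤ (suc e)) → Vec.last w ≢ + 0 →
                   ∀ M → Eventually (λ x → M ≤ ∣ horner (c ∷ w) x ∣)

horner-nonzero {zero}  (c ∷ []) c≢0 = 0 , λ x _ →
  subst (λ z → 1 ≤ ∣ z ∣) (sym (c+x*0≡c c x)) (ℕₚ.n≢0⇒n>0 (c≢0 ∘ ℤₚ.∣i∣≡0⇒i≡0))
  where
  c+x*0≡c : ∀ c x → c ℤ.+ x ℤ.* + 0 ≡ c
  c+x*0≡c = ℤSolver.solve-∀
horner-nonzero {suc e} (c ∷ w) w≢0 = horner-unbounded c w w≢0 1

horner-unbounded c w w≢0 M with horner-nonzero w w≢0
... | B , w-nonzero = B ⊔ (M ℕ.+ ∣ c ∣) , λ x B⊔≤∣x∣ →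
  ∣c+y∣-lower c (x ℤ.* horner w x) M (begin
    M ℕ.+ ∣ c ∣              ≤⟨ ℕₚ.m⊔n≤o⇒n≤o B _ B⊔≤∣x∣ ⟩
    ∣ x ∣                    ≡⟨ ℕₚ.*-identityʳ ∣ x ∣ ⟨
    ∣ x ∣ ℕ.* 1              ≤⟨ ∣x∣*M≤∣x*y∣ x (horner w x) 1 (w-nonzero x (ℕₚ.m⊔n≤o⇒m≤o B _ B⊔≤∣x∣)) ⟩
    ∣ x ℤ.* horner w x ∣     ∎)
  where open ℕₚ.≤-Reasoning

eval-expanding : ∀ {e} (f : IntPoly (suc (suc e))) → Eventually (λ x → ∣ x ∣ < ∣ eval f x ∣)
eval-expanding (mkPoly (c ∷ c′ ∷ w) lead) with horner-unbounded c′ w lead (∣ c ∣ ℕ.+ 2)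
... | B , w-large = B ⊔ 1 , λ x B⊔1≤∣x∣ →
  subst (λ z → ∣ x ∣ < ∣ z ∣) (sym (eval≡horner (mkPoly (c ∷ c′ ∷ w) lead) x))
    (∣c+y∣-lower c (x ℤ.* horner (c′ ∷ w) x) (suc ∣ x ∣) (begin
      suc ∣ x ∣ ℕ.+ ∣ c ∣              ≤⟨ linear≤quadratic (ℕₚ.m⊔n≤o⇒n≤o B 1 B⊔1≤∣x∣) ⟩
      ∣ x ∣ ℕ.* (∣ c ∣ ℕ.+ 2)          ≤⟨ ∣x∣*M≤∣x*y∣ x _ _ (w-large x (ℕₚ.m⊔n≤o⇒m≤o B 1 B⊔1≤∣x∣)) ⟩
      ∣ x ℤ.* horner (c′ ∷ w) x ∣      ∎))
  where
  open ℕₚ.≤-Reasoning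
  linear≤quadratic : ∀ {a b} → 1 ≤ a → suc a ℕ.+ b ≤ a ℕ.* (b ℕ.+ 2)
  linear≤quadratic {suc a} {b} _ = subst (suc (suc a) ℕ.+ b ≤_) (sym (expand a b)) (ℕₚ.m≤m+n _ _)
    where
    expand : ∀ a b → suc a ℕ.* (b ℕ.+ 2) ≡ (suc (suc a) ℕ.+ b) ℕ.+ a ℕ.* (b ℕ.+ 1)
    expand = ℕSolver.solve-∀

-- A record rather than a synonym for u ∣ x - y, so that x, y and u stay inferable.
infix 4 _≡_[mod_]
record _≡_[mod_] (x y u : ℤ) : Set where
  constructor mk≡mod
  field ∣-difference : u ∣ℤ x ℤ.- y
open _≡_[mod_]

mod-refl : ∀ {u} x → x ≡ x [mod u ]
mod-refl x = mk≡mod (subst (_ ∣ℤ_) (sym (ℤₚ.+-inverseʳ x)) (ℤ∣.∣ᵤ⇒∣ (ℕ∣._∣0 _)))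

mod-sym : ∀ {u x y} → x ≡ y [mod u ] → y ≡ x [mod u ]
mod-sym {u} {x} {y} (mk≡mod u∣x-y) = mk≡mod (subst (u ∣ℤ_) (neg-diff x y) (ℤ∣.∣m⇒∣-m u∣x-y))
  where
  neg-diff : ∀ x y → ℤ.- (x ℤ.- y) ≡ y ℤ.- x
  neg-diff = ℤSolver.solve-∀

mod-trans : ∀ {u x y z} → x ≡ y [mod u ] → y ≡ z [mod u ] → x ≡ z [mod u ]
mod-trans {u} {x} {y} {z} (mk≡mod u∣x-y) (mk≡mod u∣y-z) =
  mk≡mod (subst (u ∣ℤ_) (ℤₚ.+-minus-telescope x y z) (ℤ∣.∣m∣n⇒∣m+n u∣x-y u∣y-z))

horner-cong : ∀ {n u x y} (cs : Vec ℤ n) → x ≡ y [mod u ] → horner cs x ≡ horner cs y [mod u ]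
horner-cong []       _   = mod-refl (+ 0)
horner-cong {u = u} {x} {y} (c ∷ cs) x≡y = mk≡mod
  (subst (u ∣ℤ_) (sym (expand c x y (horner cs x) (horner cs y)))
    (ℤ∣.∣m∣n⇒∣m+n (ℤ∣.∣n⇒∣m*n x (∣-difference (horner-cong cs x≡y)))
                  (ℤ∣.∣m⇒∣m*n (horner cs y) (∣-difference x≡y))))
  where
  expand : ∀ c x y A B → (c ℤ.+ x ℤ.* A) ℤ.- (c ℤ.+ y ℤ.* B) ≡ x ℤ.* (A ℤ.- B) ℤ.+ (x ℤ.- y) ℤ.* B
  expand = ℤSolver.solve-∀

iter-cong : ∀ {d} (f : IntPoly d) n {u x y} → x ≡ y [mod u ] → iter f n x ≡ iter f n y [mod u ]
iter-cong f zero    x≡y = x≡y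
iter-cong f (suc n) {u} x≡y =
  subst₂ (λ a b → a ≡ b [mod u ]) (sym (eval≡horner f _)) (sym (eval≡horner f _))
    (horner-cong (coeffs f) (iter-cong f n x≡y))

InProg⇔≡mod : ∀ {t u x} → InProg t u x ⇔ x ≡ t [mod + u ]
InProg⇔≡mod = mk⇔ (mk≡mod ∘ ℤ∣.∣ᵤ⇒∣) (ℤ∣.∣⇒∣ᵤ ∘ ∣-difference)

iter-+ : ∀ {d} (f : IntPoly d) m n x → iter f (m ℕ.+ n) x ≡ iter f m (iter f n x)
iter-+ f zero    n x = refl
iter-+ f (suc m) n x = cong (eval f) (iter-+ f m n x)

least-witness : ∀ {P : ℕ → Set} → Decidable P → ∀ {w} → P w →
                ∃ λ K → P K × (∀ {k} → k < K → ¬ P k)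
least-witness {P} P? {w} Pw with search (suc w)
  where
  search : ∀ n → (∃ λ K → P K × (∀ {k} → k < K → ¬ P k)) ⊎ (∀ {k} → k < n → ¬ P k)
  search zero = inj₂ λ ()
  search (suc n) with search n | P? n
  ... | inj₁ found | _      = inj₁ found
  ... | inj₂ below | yes Pn = inj₁ (n , Pn , below)
  ... | inj₂ below | no ¬Pn = inj₂ λ k<1+n → case ℕₚ.m≤n⇒m<n∨m≡n (ℕₚ.≤-pred k<1+n) of λ where
    (inj₁ k<n)  → below k<n
    (inj₂ refl) → ¬Pn
... | inj₁ found = found
... | inj₂ none  = ⊥-elim (none (ℕₚ.n<1+n w) Pw)

encode : ∀ B x → ∣ x ∣ < B → Fin (B ℕ.+ B)
encode B (+ n)    n<B = Fin.fromℕ< (ℕₚ.≤-trans n<B (ℕₚ.m≤m+n B B))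
encode B -[1+ n ] n<B = Fin.fromℕ< (ℕₚ.+-monoʳ-< B (ℕₚ.≤-trans (ℕₚ.n≤1+n (suc n)) n<B))

encode-injective : ∀ B x y (x<B : ∣ x ∣ < B) (y<B : ∣ y ∣ < B) →
                   encode B x x<B ≡ encode B y y<B → x ≡ y
encode-injective B (+ m)    (+ n)    _   _   eq = cong +_ (Finₚ.fromℕ<-injective m n _ _ eq)
encode-injective B (+ m)    -[1+ n ] m<B _   eq =
  ⊥-elim (ℕₚ.<⇒≱ m<B (subst (B ≤_) (sym (Finₚ.fromℕ<-injective _ _ _ _ eq)) (ℕₚ.m≤m+n B n)))
encode-injective B -[1+ m ] (+ n)    _   n<B eq =
  ⊥-elim (ℕₚ.<⇒≱ n<B (subst (B ≤_) (Finₚ.fromℕ<-injective _ _ _ _ eq) (ℕₚ.m≤m+n B m)))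
encode-injective B -[1+ m ] -[1+ n ] _   _   eq =
  cong -[1+_] (ℕₚ.+-cancelˡ-≡ B m n (Finₚ.fromℕ<-injective _ _ _ _ eq))

-- Pigeonhole: the first 2B + 1 values cannot all lie strictly inside (-B, B).
injective⇒unbounded : (g : ℕ → ℤ) → (∀ {a b} → g a ≡ g b → a ≡ b) → ∀ B → ∃ λ k → B ≤ ∣ g k ∣
injective⇒unbounded g g-injective B
  with Finₚ.¬∀⟶∃¬ (suc (B ℕ.+ B)) (λ i → ∣ g (Fin.toℕ i) ∣ < B) (λ i → ∣ g (Fin.toℕ i) ∣ ℕ.<? B) allSmall
  where
  allSmall : ¬ (∀ i → ∣ g (Fin.toℕ i) ∣ < B)
  allSmall small = ℕₚ.<-irrefl refl (Finₚ.injective⇒≤ {f = λ i → encode B (g (Fin.toℕ i)) (small i)}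
    (λ {i} {j} eq → Finₚ.toℕ-injective (g-injective (encode-injective B _ _ (small i) (small j) eq))))
... | i , ¬small = Fin.toℕ i , ℕₚ.≮⇒≥ ¬small

module EventuallyIncreasing (h : ℕ → ℕ) (k₀ : ℕ) (increasing : ∀ k → k₀ ≤ k → h k < h (suc k)) where

  increasing-+ : ∀ j a → k₀ ≤ a → h a ≤ h (j ℕ.+ a)
  increasing-+ zero    a k₀≤a = ℕₚ.≤-refl
  increasing-+ (suc j) a k₀≤a =
    ℕₚ.<⇒≤ (ℕₚ.≤-<-trans (increasing-+ j a k₀≤a) (increasing (j ℕ.+ a) (ℕₚ.≤-trans k₀≤a (ℕₚ.m≤n+m a j))))

  monotone : ∀ {a b} → k₀ ≤ a → a ≤ b → h a ≤ h b
  monotone {a} {b} k₀≤a a≤b = subst (λ i → h a ≤ h i) (ℕₚ.m∸n+n≡m a≤b) (increasing-+ (b ℕ.∸ a) a k₀≤a)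

  unbounded : ∀ j → j ≤ h (j ℕ.+ k₀)
  unbounded zero    = z≤n
  unbounded (suc j) = ℕₚ.≤-<-trans (unbounded j) (increasing (j ℕ.+ k₀) (ℕₚ.m≤n+m k₀ j))

  maxBelow : ℕ → ℕ
  maxBelow zero    = 0
  maxBelow (suc n) = maxBelow n ⊔ h n

  ≤maxBelow : ∀ {k n} → k < n → h k ≤ maxBelow n
  ≤maxBelow {k} {suc n} k<1+n with ℕₚ.m≤n⇒m<n∨m≡n (ℕₚ.≤-pred k<1+n)
  ... | inj₁ k<n  = ℕₚ.≤-trans (≤maxBelow k<n) (ℕₚ.m≤m⊔n _ _)
  ... | inj₂ refl = ℕₚ.m≤n⊔m _ _

  -- K is the first index past k₀ at which h exceeds X.
  initialSegment : ∀ Kmin X → maxBelow (suc (k₀ ⊔ Kmin)) ≤ X →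
                   ∃ λ K → Kmin < K × (∀ k → h k ≤ X ⇔ k < K)
  initialSegment Kmin X maxBelow≤X = K , Kmin<K , λ k → mk⇔ (small⇒below k) (below⇒small k)
    where
    Exceeds : ℕ → Set
    Exceeds k = k₀ ≤ k × X < h k
    exceeds? : Decidable Exceeds
    exceeds? k = (k₀ ℕ.≤? k) ×-dec (X ℕ.<? h k)
    first = least-witness exceeds? {suc X ℕ.+ k₀} (ℕₚ.m≤n+m k₀ (suc X) , unbounded (suc X))
    K = proj₁ first
    K-exceeds = proj₁ (proj₂ first)
    K-least = proj₂ (proj₂ first)

    early : ∀ {k} → k ≤ k₀ ⊔ Kmin → h k ≤ X
    early k≤ = ℕₚ.≤-trans (≤maxBelow (s≤s k≤)) maxBelow≤X

    Kmin<K : Kmin < K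
    Kmin<K = ℕₚ.≤-<-trans (ℕₚ.m≤n⊔m k₀ Kmin)
      (ℕₚ.≰⇒> λ K≤ → ℕₚ.<⇒≱ (proj₂ K-exceeds) (early K≤))

    small⇒below : ∀ k → h k ≤ X → k < K
    small⇒below k hk≤X = ℕₚ.≰⇒> λ K≤k →
      ℕₚ.<⇒≱ (proj₂ K-exceeds) (ℕₚ.≤-trans (monotone (proj₁ K-exceeds) K≤k) hk≤X)

    below⇒small : ∀ k → k < K → h k ≤ X
    below⇒small k k<K with k ℕ.≤? k₀
    ... | yes k≤k₀ = early (ℕₚ.≤-trans k≤k₀ (ℕₚ.m≤m⊔n k₀ Kmin))
    ... | no  k≰k₀ = ℕₚ.≮⇒≥ λ X<hk → K-least k<K (ℕₚ.<⇒≤ (ℕₚ.≰⇒> k≰k₀) , X<hk)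

-- Counting along periodic predicates

count : (ℕ → Bool) → ℕ → ℕ
count p zero    = 0
count p (suc K) = if p 0 then suc (count (p ∘ suc) K) else count (p ∘ suc) K

count-cong : ∀ {p q} → (∀ k → p k ≡ q k) → ∀ K → count p K ≡ count q K
count-cong p≗q zero    = refl
count-cong p≗q (suc K) =
  cong₂ (λ b n → if b then suc n else n) (p≗q 0) (count-cong (p≗q ∘ suc) K)

count-≤ : ∀ p K → count p K ≤ K
count-≤ p zero = z≤n
count-≤ p (suc K) with p 0
... | true  = s≤s (count-≤ (p ∘ suc) K)
... | false = ℕₚ.m≤n⇒m≤1+n (count-≤ (p ∘ suc) K)

count-false : ∀ {p K} → (∀ {k} → k < K → p k ≡ false) → count p K ≡ 0
count-false {p} {zero}  _     = refl
count-false {p} {suc K} all-false rewrite all-false (s≤s z≤n) = count-false (all-false ∘ s≤s)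

count-+ : ∀ p L K → count p (L ℕ.+ K) ≡ count p L ℕ.+ count (λ j → p (L ℕ.+ j)) K
count-+ p zero    K = refl
count-+ p (suc L) K with p 0
... | true  = cong suc (count-+ (p ∘ suc) L K)
... | false = count-+ (p ∘ suc) L K

count-periodic : ∀ {p L} → (∀ j → p (L ℕ.+ j) ≡ p j) →
                 ∀ q r → count p (q ℕ.* L ℕ.+ r) ≡ q ℕ.* count p L ℕ.+ count p r
count-periodic         periodic zero    r = refl
count-periodic {p} {L} periodic (suc q) r = begin
  count p (L ℕ.+ q ℕ.* L ℕ.+ r)                     ≡⟨ cong (count p) (ℕₚ.+-assoc L (q ℕ.* L) r) ⟩
  count p (L ℕ.+ (q ℕ.* L ℕ.+ r))                   ≡⟨ count-+ p L (q ℕ.* L ℕ.+ r) ⟩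
  count p L ℕ.+ count (λ j → p (L ℕ.+ j)) (q ℕ.* L ℕ.+ r) ≡⟨ cong (count p L ℕ.+_) (count-cong periodic (q ℕ.* L ℕ.+ r)) ⟩
  count p L ℕ.+ count p (q ℕ.* L ℕ.+ r)             ≡⟨ cong (count p L ℕ.+_) (count-periodic periodic q r) ⟩
  count p L ℕ.+ (q ℕ.* count p L ℕ.+ count p r)     ≡⟨ ℕₚ.+-assoc (count p L) _ _ ⟨
  suc q ℕ.* count p L ℕ.+ count p r                 ∎
  where open ≡-Reasoning

-- Splitting K = q L + r with r < L, the count is q · count p L up to an
-- error below L on each side.
count-periodic-error : ∀ {p} L .{{_ : ℕ.NonZero L}} → (∀ j → p (L ℕ.+ j) ≡ p j) →
                       ∀ K → ∣ count p K ℕ.* L ⊖ count p L ℕ.* K ∣ ≤ L ℕ.* L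
count-periodic-error {p} L periodic K = begin
  ∣ count p K ℕ.* L ⊖ c ℕ.* K ∣                            ≡⟨ cong ∣_∣ (cong₂ _⊖_ NL≡ cK≡) ⟩
  ∣ (q ℕ.* c ℕ.* L ℕ.+ count p r ℕ.* L) ⊖ (q ℕ.* c ℕ.* L ℕ.+ c ℕ.* r) ∣ ≡⟨ cong ∣_∣ (ℤₚ.+-cancelˡ-⊖ (q ℕ.* c ℕ.* L) _ _) ⟩
  ∣ count p r ℕ.* L ⊖ c ℕ.* r ∣                            ≤⟨ ℤₚ.∣m⊝n∣≤m⊔n (count p r ℕ.* L) (c ℕ.* r) ⟩
  count p r ℕ.* L ⊔ c ℕ.* r                               ≤⟨ ℕₚ.⊔-lub (ℕₚ.*-monoˡ-≤ L (ℕₚ.≤-trans (count-≤ p r) r≤L))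
                                                                      (ℕₚ.*-mono-≤ (count-≤ p L) r≤L) ⟩
  L ℕ.* L                                                 ∎
  where
  open ℕₚ.≤-Reasoning
  c = count p L
  q = K / L
  r = K % L
  r≤L = ℕₚ.<⇒≤ (ℕDM.m%n<n K L)
  K≡ : K ≡ q ℕ.* L ℕ.+ r
  K≡ = trans (ℕDM.m≡m%n+[m/n]*n K L) (ℕₚ.+-comm r _)
  NL≡ : count p K ℕ.* L ≡ q ℕ.* c ℕ.* L ℕ.+ count p r ℕ.* L
  NL≡ = begin-equality
    count p K ℕ.* L                         ≡⟨ cong (λ k → count p k ℕ.* L) K≡ ⟩
    count p (q ℕ.* L ℕ.+ r) ℕ.* L           ≡⟨ cong (ℕ._* L) (count-periodic periodic q r) ⟩
    (q ℕ.* c ℕ.+ count p r) ℕ.* L           ≡⟨ ℕₚ.*-distribʳ-+ L (q ℕ.* c) _ ⟩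
    q ℕ.* c ℕ.* L ℕ.+ count p r ℕ.* L       ∎
  cK≡ : c ℕ.* K ≡ q ℕ.* c ℕ.* L ℕ.+ c ℕ.* r
  cK≡ = trans (cong (c ℕ.*_) K≡) (expand c q L r)
    where
    expand : ∀ c q L r → c ℕ.* (q ℕ.* L ℕ.+ r) ≡ q ℕ.* c ℕ.* L ℕ.+ c ℕ.* r
    expand = ℕSolver.solve-∀

count-∨+count-∧ : ∀ p q K → count (λ k → p k ∨ q k) K ℕ.+ count (λ k → p k ∧ q k) K
                            ≡ count p K ℕ.+ count q K
count-∨+count-∧ p q zero = refl
count-∨+count-∧ p q (suc K) with p 0 | q 0 | count-∨+count-∧ (p ∘ suc) (q ∘ suc) K
... | true  | true  | ih = cong suc (trans (ℕₚ.+-suc _ _) (trans (cong suc ih) (sym (ℕₚ.+-suc _ _))))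
... | true  | false | ih = cong suc ih
... | false | true  | ih = trans (cong suc ih) (sym (ℕₚ.+-suc _ _))
... | false | false | ih = ih

length-filter-applyUpTo : ∀ {A : Set} {P : A → Set} (P? : Decidable P) (g : ℕ → A) K →
                          List.length (List.filter P? (List.applyUpTo g K)) ≡ count (λ j → does (P? (g j))) K
length-filter-applyUpTo P? g zero = refl
length-filter-applyUpTo P? g (suc K) with does (P? (g 0))
... | true  = cong suc (length-filter-applyUpTo P? (g ∘ suc) K)
... | false = length-filter-applyUpTo P? (g ∘ suc) K

-- Divisibility patterns

_∣ᵇ_ : ℕ → ℕ → Bool
a ∣ᵇ k = does (a ℕ∣.∣? k)

∣-periodic : ∀ {a L} → a ℕ∣.∣ L → ∀ j → a ℕ∣.∣ L ℕ.+ j ⇔ a ℕ∣.∣ j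
∣-periodic a∣L j = mk⇔ (flip ℕ∣.∣m+n∣m⇒∣n a∣L) (ℕ∣.∣m∣n⇒∣m+n a∣L)

∣ᵇ-periodic : ∀ {a L} → a ℕ∣.∣ L → ∀ j → a ∣ᵇ (L ℕ.+ j) ≡ a ∣ᵇ j
∣ᵇ-periodic a∣L j = does-⇔ (∣-periodic a∣L j) (_ ℕ∣.∣? _) (_ ℕ∣.∣? _)

count-∣ᵇ : ∀ a .{{_ : ℕ.NonZero a}} m → count (a ∣ᵇ_) (m ℕ.* a) ≡ m
count-∣ᵇ a m = begin
  count (a ∣ᵇ_) (m ℕ.* a)                       ≡⟨ cong (count (a ∣ᵇ_)) (ℕₚ.+-identityʳ (m ℕ.* a)) ⟨
  count (a ∣ᵇ_) (m ℕ.* a ℕ.+ 0)                 ≡⟨ count-periodic (∣ᵇ-periodic (ℕ∣.∣-refl {a})) m 0 ⟩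
  m ℕ.* count (a ∣ᵇ_) a ℕ.+ 0                   ≡⟨ cong (λ n → m ℕ.* n ℕ.+ 0) (one-per-period a) ⟩
  m ℕ.* 1 ℕ.+ 0                                 ≡⟨ trans (ℕₚ.+-identityʳ _) (ℕₚ.*-identityʳ m) ⟩
  m                                             ∎
  where
  open ≡-Reasoning
  one-per-period : ∀ a .{{_ : ℕ.NonZero a}} → count (a ∣ᵇ_) a ≡ 1
  one-per-period (suc a′) rewrite dec-true (suc a′ ℕ∣.∣? 0) (ℕ∣._∣0 _) =
    cong suc (count-false {K = a′} λ k<a′ → dec-false (_ ℕ∣.∣? _) λ a∣1+k → ℕₚ.<⇒≱ (s≤s k<a′) (ℕ∣.∣⇒≤ a∣1+k))

coprime⇒*∣ : ∀ {a b k} → Coprime a b → a ℕ∣.∣ k → b ℕ∣.∣ k → a ℕ.* b ℕ∣.∣ k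
coprime⇒*∣ {a} {b} a⊥b (ℕ∣.divides q refl) b∣qa
  with Coprime.coprime-divisor (Coprime.sym a⊥b) (subst (b ℕ∣.∣_) (ℕₚ.*-comm q a) b∣qa)
... | ℕ∣.divides r refl = ℕ∣.divides r (trans (ℕₚ.*-assoc r b a) (cong (r ℕ.*_) (ℕₚ.*-comm b a)))

coprime-*ˡ : ∀ {a b c} → Coprime a c → Coprime b c → Coprime (a ℕ.* b) c
coprime-*ˡ {a} a⊥c b⊥c (d∣ab , d∣c) = b⊥c (Coprime.coprime-divisor d⊥a d∣ab , d∣c)
  where
  d⊥a : Coprime _ a
  d⊥a (e∣d , e∣a) = a⊥c (e∣a , ℕ∣.∣-trans e∣d d∣c)

IsLcm : ℕ → ℕ → ℕ → Set
IsLcm a b l = ∀ k → (a ℕ∣.∣ k × b ℕ∣.∣ k) ⇔ l ℕ∣.∣ k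

coprime⇒isLcm : ∀ {a b} → Coprime a b → IsLcm a b (a ℕ.* b)
coprime⇒isLcm {a} {b} a⊥b k = mk⇔
  (λ (a∣k , b∣k) → coprime⇒*∣ a⊥b a∣k b∣k)
  (λ ab∣k → ℕ∣.∣-trans (ℕ∣.m∣m*n b) ab∣k , ℕ∣.∣-trans (ℕ∣.n∣m*n a) ab∣k)

coprime⇒isLcm-*ˡ : ∀ {a b c} → Coprime a c → Coprime b c → IsLcm (a ℕ.* b) (a ℕ.* c) (a ℕ.* b ℕ.* c)
coprime⇒isLcm-*ˡ {a} {b} {c} a⊥c b⊥c k = mk⇔
  (λ (ab∣k , ac∣k) → coprime⇒*∣ (coprime-*ˡ a⊥c b⊥c) ab∣k (ℕ∣.∣-trans (ℕ∣.n∣m*n a) ac∣k))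
  (λ abc∣k → ℕ∣.∣-trans (ℕ∣.m∣m*n c) abc∣k , ℕ∣.∣-trans (subst (a ℕ.* c ℕ∣.∣_) (abc≡acb a b c) (ℕ∣.m∣m*n b)) abc∣k)
  where
  abc≡acb : ∀ a b c → a ℕ.* c ℕ.* b ≡ a ℕ.* b ℕ.* c
  abc≡acb = ℕSolver.solve-∀

∣ᵇ-∧ : ∀ {a b l} → IsLcm a b l → ∀ k → (a ∣ᵇ k) ∧ (b ∣ᵇ k) ≡ l ∣ᵇ k
∣ᵇ-∧ {a} {b} {l} lcm k = does-⇔ (lcm k) (a ℕ∣.∣? k ×-dec b ℕ∣.∣? k) (l ℕ∣.∣? k)

count-∣ᵇ′ : ∀ {a} .{{_ : ℕ.NonZero a}} m {L} → L ≡ m ℕ.* a → count (a ∣ᵇ_) L ≡ m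
count-∣ᵇ′ {a} m refl = count-∣ᵇ a m

count-∣ᵇ-∨ : ∀ {a b l} .{{_ : ℕ.NonZero a}} .{{_ : ℕ.NonZero b}} .{{_ : ℕ.NonZero l}} →
             IsLcm a b l → ∀ {L} p q r → L ≡ p ℕ.* a → L ≡ q ℕ.* b → L ≡ r ℕ.* l →
             count (λ k → a ∣ᵇ k ∨ b ∣ᵇ k) L ℕ.+ r ≡ p ℕ.+ q
count-∣ᵇ-∨ {a} {b} {l} lcm {L} p q r L≡pa L≡qb L≡rl = begin
  count (λ k → a ∣ᵇ k ∨ b ∣ᵇ k) L ℕ.+ r                                    ≡⟨ cong (count (λ k → a ∣ᵇ k ∨ b ∣ᵇ k) L ℕ.+_) both ⟨
  count (λ k → a ∣ᵇ k ∨ b ∣ᵇ k) L ℕ.+ count (λ k → a ∣ᵇ k ∧ b ∣ᵇ k) L      ≡⟨ count-∨+count-∧ (a ∣ᵇ_) (b ∣ᵇ_) L ⟩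
  count (a ∣ᵇ_) L ℕ.+ count (b ∣ᵇ_) L                                      ≡⟨ cong₂ ℕ._+_ (count-∣ᵇ′ p L≡pa) (count-∣ᵇ′ q L≡qb) ⟩
  p ℕ.+ q                                                                  ∎
  where
  open ≡-Reasoning
  both : count (λ k → a ∣ᵇ k ∧ b ∣ᵇ k) L ≡ r
  both = trans (count-cong (∣ᵇ-∧ lcm) L) (count-∣ᵇ′ r L≡rl)

count-∣ᵇ-∨₂ : ∀ a b .{{_ : ℕ.NonZero a}} .{{_ : ℕ.NonZero b}} → Coprime a b →
              count (λ k → a ∣ᵇ k ∨ b ∣ᵇ k) (a ℕ.* b) ℕ.+ 1 ≡ b ℕ.+ a
count-∣ᵇ-∨₂ a b a⊥b =
  count-∣ᵇ-∨ (coprime⇒isLcm a⊥b) b a 1 (ℕₚ.*-comm a b) refl (sym (ℕₚ.*-identityˡ (a ℕ.* b)))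
  where instance _ = ℕₚ.m*n≢0 a b

count-∣ᵇ-∨₃ : ∀ a b c .{{_ : ℕ.NonZero a}} .{{_ : ℕ.NonZero b}} .{{_ : ℕ.NonZero c}} →
              Coprime a b → Coprime a c → Coprime b c →
              count (λ k → a ∣ᵇ k ∨ (b ∣ᵇ k ∨ c ∣ᵇ k)) (a ℕ.* b ℕ.* c) ℕ.+ (c ℕ.+ b ℕ.+ a)
                ≡ b ℕ.* c ℕ.+ a ℕ.* c ℕ.+ a ℕ.* b ℕ.+ 1
count-∣ᵇ-∨₃ a b c a⊥b a⊥c b⊥c = begin
  X ℕ.+ (c ℕ.+ b ℕ.+ a)                         ≡⟨ cong (λ w → X ℕ.+ (w ℕ.+ a)) (count-a∧[b∨c]) ⟨
  X ℕ.+ (Y ℕ.+ 1 ℕ.+ a)                         ≡⟨ regroup₁ X Y a ⟩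
  (X ℕ.+ Y) ℕ.+ (a ℕ.+ 1)                       ≡⟨ cong (ℕ._+ (a ℕ.+ 1)) count-a∨[b∨c] ⟩
  (b ℕ.* c ℕ.+ Z) ℕ.+ (a ℕ.+ 1)                 ≡⟨ regroup₂ (b ℕ.* c) Z a ⟩
  b ℕ.* c ℕ.+ (Z ℕ.+ a) ℕ.+ 1                   ≡⟨ cong (λ w → b ℕ.* c ℕ.+ w ℕ.+ 1) count-b∨c ⟩
  b ℕ.* c ℕ.+ (a ℕ.* c ℕ.+ a ℕ.* b) ℕ.+ 1       ≡⟨ cong (ℕ._+ 1) (ℕₚ.+-assoc (b ℕ.* c) _ _) ⟨
  b ℕ.* c ℕ.+ a ℕ.* c ℕ.+ a ℕ.* b ℕ.+ 1         ∎
  where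
  open ≡-Reasoning
  instance
    _ = ℕₚ.m*n≢0 a b
    _ = ℕₚ.m*n≢0 a c
    _ = ℕₚ.m*n≢0 b c
    _ = ℕₚ.m*n≢0 (a ℕ.* b) c
  L≡bc*a : ∀ a b c → a ℕ.* b ℕ.* c ≡ b ℕ.* c ℕ.* a
  L≡bc*a = ℕSolver.solve-∀
  L≡ac*b : ∀ a b c → a ℕ.* b ℕ.* c ≡ a ℕ.* c ℕ.* b
  L≡ac*b = ℕSolver.solve-∀
  L≡b*ac : ∀ a b c → a ℕ.* b ℕ.* c ≡ b ℕ.* (a ℕ.* c)
  L≡b*ac = ℕSolver.solve-∀
  regroup₁ : ∀ X Y a → X ℕ.+ (Y ℕ.+ 1 ℕ.+ a) ≡ X ℕ.+ Y ℕ.+ (a ℕ.+ 1)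
  regroup₁ = ℕSolver.solve-∀
  regroup₂ : ∀ P Z a → P ℕ.+ Z ℕ.+ (a ℕ.+ 1) ≡ P ℕ.+ (Z ℕ.+ a) ℕ.+ 1
  regroup₂ = ℕSolver.solve-∀
  L = a ℕ.* b ℕ.* c
  X = count (λ k → a ∣ᵇ k ∨ (b ∣ᵇ k ∨ c ∣ᵇ k)) L
  Y = count (λ k → a ∣ᵇ k ∧ (b ∣ᵇ k ∨ c ∣ᵇ k)) L
  Z = count (λ k → b ∣ᵇ k ∨ c ∣ᵇ k) L

  count-a∨[b∨c] : X ℕ.+ Y ≡ b ℕ.* c ℕ.+ Z
  count-a∨[b∨c] = trans (count-∨+count-∧ (a ∣ᵇ_) (λ k → b ∣ᵇ k ∨ c ∣ᵇ k) L)
                        (cong (ℕ._+ Z) (count-∣ᵇ′ (b ℕ.* c) (L≡bc*a a b c)))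

  count-b∨c : Z ℕ.+ a ≡ a ℕ.* c ℕ.+ a ℕ.* b
  count-b∨c = count-∣ᵇ-∨ (coprime⇒isLcm b⊥c) (a ℕ.* c) (a ℕ.* b) a
    (L≡ac*b a b c) refl (ℕₚ.*-assoc a b c)

  count-a∧[b∨c] : Y ℕ.+ 1 ≡ c ℕ.+ b
  count-a∧[b∨c] = trans
    (cong (ℕ._+ 1) (count-cong (λ k → trans (Boolₚ.∧-distribˡ-∨ (a ∣ᵇ k) _ _)
                                      (cong₂ _∨_ (∣ᵇ-∧ (coprime⇒isLcm a⊥b) k) (∣ᵇ-∧ (coprime⇒isLcm a⊥c) k))) L))
    (count-∣ᵇ-∨ (coprime⇒isLcm-*ˡ a⊥c b⊥c) c b 1 (ℕₚ.*-comm (a ℕ.* b) c) (L≡b*ac a b c) (sym (ℕₚ.*-identityˡ L)))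

any-∣-periodic : ∀ {k L} {as : Vec ℕ k} → All (ℕ∣._∣ L) as → ∀ j → Any (ℕ∣._∣ L ℕ.+ j) as ⇔ Any (ℕ∣._∣ j) as
any-∣-periodic []           j = mk⇔ (λ ()) (λ ())
any-∣-periodic (a∣L ∷ rest) j =
  ⇔-trans (mk⇔ Any.toSum Any.fromSum) (⇔-trans (∣-periodic a∣L j ⊎-⇔ any-∣-periodic rest j) (mk⇔ Any.fromSum Any.toSum))

-- |N/K - c/L| = |N L - c K| / (K L) ≤ L / K, which is below ε = n/e once K > L e.
frac-close : ∀ N c k l → let K = suc k ; L = suc l in
             ∣ N ℕ.* L ⊖ c ℕ.* K ∣ ≤ L ℕ.* L → ∀ ε → ℚ.0ℚ ℚ.< ε → L ℕ.* ℚ.↧ₙ ε < K →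
             ℚ.∣ frac (+ N) (+ K) ℚ.- frac (+ c) (+ L) ∣ ℚ.< ε
frac-close N c k l err (ℚ.mkℚ (+ zero)   _ _) (ℚ.*<* (ℤ.+<+ ()))
frac-close N c k l err (ℚ.mkℚ -[1+ _ ]   _ _) (ℚ.*<* ())
frac-close N c k l err ε@(ℚ.mkℚ (+ suc n) e-1 _) _ K>Le =
  ℚₚ.toℚᵘ-cancel-< (ℚᵘₚ.<-respˡ-≃ (ℚᵘₚ.≃-sym as-unnormalised) (ℚᵘ.*<* (ℤₚ.+◃-mono-< cross)))
  where
  K = suc k
  L = suc l
  e = suc e-1
  N/K = ℚᵘ.mkℚᵘ (+ N) k
  c/L = ℚᵘ.mkℚᵘ (+ c) l
  as-unnormalised : ℚ.toℚᵘ (ℚ.∣ frac (+ N) (+ K) ℚ.- frac (+ c) (+ L) ∣) ℚᵘ.≃ ℚᵘ.∣ N/K ℚᵘ.+ ℚᵘ.- c/L ∣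
  as-unnormalised = ℚᵘₚ.≃-trans (ℚₚ.toℚᵘ-homo-∣-∣ (N/K′ ℚ.- c/L′)) (ℚᵘₚ.∣-∣-cong
    (ℚᵘₚ.≃-trans (ℚₚ.toℚᵘ-homo-+ N/K′ (ℚ.- c/L′)) (ℚᵘₚ.+-cong (ℚₚ.toℚᵘ-fromℚᵘ N/K)
      (ℚᵘₚ.≃-trans (ℚₚ.toℚᵘ-homo‿- c/L′) (ℚᵘₚ.-‿cong (ℚₚ.toℚᵘ-fromℚᵘ c/L))))))
    where
    N/K′ = frac (+ N) (+ K)
    c/L′ = frac (+ c) (+ L)
  numerator≡ : + N ℤ.* + L ℤ.+ ℤ.- (+ c) ℤ.* + K ≡ N ℕ.* L ⊖ c ℕ.* K
  numerator≡ = trans (cong₂ ℤ._+_ (ℤₚ.+◃n≡+n (N ℕ.* L))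
                               (trans (sym (ℤₚ.neg-distribˡ-* (+ c) (+ K))) (cong ℤ.-_ (ℤₚ.+◃n≡+n (c ℕ.* K)))))
                     (ℤₚ.m-n≡m⊖n (N ℕ.* L) (c ℕ.* K))
  cross : ∣ + N ℤ.* + L ℤ.+ ℤ.- (+ c) ℤ.* + K ∣ ℕ.* e < suc n ℕ.* (K ℕ.* L)
  cross = begin-strict
    ∣ + N ℤ.* + L ℤ.+ ℤ.- (+ c) ℤ.* + K ∣ ℕ.* e  ≡⟨ cong (λ z → ∣ z ∣ ℕ.* e) numerator≡ ⟩
    ∣ N ℕ.* L ⊖ c ℕ.* K ∣ ℕ.* e                 ≤⟨ ℕₚ.*-monoˡ-≤ e err ⟩
    L ℕ.* L ℕ.* e                               ≡⟨ ℕₚ.*-assoc L L e ⟩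
    L ℕ.* (L ℕ.* e)                             <⟨ ℕₚ.*-monoʳ-< L K>Le ⟩
    L ℕ.* K                                     ≡⟨ ℕₚ.*-comm L K ⟩
    K ℕ.* L                                     ≤⟨ ℕₚ.m≤m+n (K ℕ.* L) (n ℕ.* (K ℕ.* L)) ⟩
    suc n ℕ.* (K ℕ.* L)                         ∎
    where open ℕₚ.≤-Reasoning

frac-cross : ∀ p q M N .{{_ : ℕ.NonZero M}} .{{_ : ℕ.NonZero N}} →
             p ℕ.* N ≡ q ℕ.* M → frac (+ p) (+ M) ≡ frac (+ q) (+ N)
frac-cross p q zero    _       _  = ⊥-elim (ℕ.≢-nonZero⁻¹ 0 refl)
frac-cross p q (suc m) zero    _  = ⊥-elim (ℕ.≢-nonZero⁻¹ 0 refl)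
frac-cross p q (suc m) (suc n) eq =
  ℚₚ.fromℚᵘ-cong {ℚᵘ.mkℚᵘ (+ p) m} {ℚᵘ.mkℚᵘ (+ q) n} (ℚᵘ.*≡* (cong (Sign.+ ℤ.◃_) eq))

coprime-1+ : ∀ {m q} → q ℕ∣.∣ m → Coprime (suc m) q
coprime-1+ {m} q∣m {d} (d∣1+m , d∣q) =
  ℕ∣.∣1⇒≡1 (ℕ∣.∣m+n∣m⇒∣n (subst (d ℕ∣.∣_) (ℕₚ.+-comm 1 m) d∣1+m) (ℕ∣.∣-trans d∣q q∣m))

-- A common divisor of c and 2 + c divides 2, hence the even number 2 j, hence 2 j + 1 - 2 j.
coprime-2+odd : ∀ {c} j → + c ≡ + 2 ℤ.* j ℤ.+ + 1 → Coprime (2 ℕ.+ c) c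
coprime-2+odd {c} j c≡2j+1 {d} (d∣2+c , d∣c) = ℕ∣.∣1⇒≡1 (ℤ∣.∣⇒∣ᵤ (ℤ∣.∣m+n∣m⇒∣n d∣2j+1 d∣2j))
  where
  d∣2 : d ℕ∣.∣ 2
  d∣2 = ℕ∣.∣m+n∣m⇒∣n (subst (d ℕ∣.∣_) (ℕₚ.+-comm 2 c) d∣2+c) d∣c
  d∣2j : + d ∣ℤ + 2 ℤ.* j
  d∣2j = ℤ∣.∣m⇒∣m*n {m = + 2} j (ℤ∣.∣ᵤ⇒∣ d∣2)
  d∣2j+1 : + d ∣ℤ + 2 ℤ.* j ℤ.+ + 1
  d∣2j+1 = subst (+ d ∣ℤ_) c≡2j+1 (ℤ∣.∣ᵤ⇒∣ d∣c)

+n-+k≡+m⇒n≡k+m : ∀ n k {m} → + n ℤ.- + k ≡ + m → n ≡ k ℕ.+ m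
+n-+k≡+m⇒n≡k+m n k {m} eq = ℤₚ.+-injective (begin
  + n                      ≡⟨ n≡k+[n-k] (+ n) (+ k) ⟩
  + k ℤ.+ (+ n ℤ.- + k)    ≡⟨ cong (ℤ._+_ (+ k)) eq ⟩
  + k ℤ.+ + m              ≡⟨ ℤₚ.pos-+ k m ⟨
  + (k ℕ.+ m)              ∎)
  where
  open ≡-Reasoning
  n≡k+[n-k] : ∀ n k → n ≡ k ℤ.+ (n ℤ.- k)
  n≡k+[n-k] = ℤSolver.solve-∀

-- Orbits

module Orbit {d} (f : IntPoly d) (t : ℤ) where

  orb : ℕ → ℤ
  orb k = iter f k t

  orb-periodic : ∀ {n u} → orb n ≡ t [mod u ] → ∀ q r → orb (q ℕ.* n ℕ.+ r) ≡ orb r [mod u ]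
  orb-periodic         orbₙ≡t zero    r = mod-refl (orb r)
  orb-periodic {n} {u} orbₙ≡t (suc q) r = mod-trans shift (orb-periodic orbₙ≡t q r)
    where
    shift : orb (suc q ℕ.* n ℕ.+ r) ≡ orb (q ℕ.* n ℕ.+ r) [mod u ]
    shift = subst (λ a → a ≡ orb (q ℕ.* n ℕ.+ r) [mod u ])
      (trans (sym (iter-+ f (q ℕ.* n ℕ.+ r) n t)) (cong orb (rearrange q n r)))
      (iter-cong f (q ℕ.* n ℕ.+ r) orbₙ≡t)
      where
      rearrange : ∀ q n r → q ℕ.* n ℕ.+ r ℕ.+ n ≡ suc q ℕ.* n ℕ.+ r
      rearrange = ℕSolver.solve-∀

  -- Reduce k modulo n and use primitivity on the remainder.
  primitiveDivisor-∣⇔ : ∀ {n u} .{{_ : ℕ.NonZero n}} → PrimitiveDivisor (λ k → orb k ℤ.- t) n u →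
                        ∀ k → InProg t u (orb k) ⇔ n ℕ∣.∣ k
  primitiveDivisor-∣⇔ {n} {u} (_ , u∣aₙ , earlier∤) k = mk⇔ to from
    where
    reduce : orb k ≡ orb (k % n) [mod + u ]
    reduce = subst (λ i → orb i ≡ orb (k % n) [mod + u ])
      (trans (ℕₚ.+-comm _ (k % n)) (sym (ℕDM.m≡m%n+[m/n]*n k n)))
      (orb-periodic (Equivalence.to InProg⇔≡mod u∣aₙ) (k / n) (k % n))
    to : InProg t u (orb k) → n ℕ∣.∣ k
    to u∣aₖ with k % n in k%n≡r
    ... | zero  = ℕ∣.m%n≡0⇒n∣m k n k%n≡r
    ... | suc r = ⊥-elim (earlier∤ (suc r) (s≤s z≤n) (subst (_< n) k%n≡r (ℕDM.m%n<n k n))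
                    (Equivalence.from InProg⇔≡mod
                      (mod-trans (mod-sym (subst (λ i → orb k ≡ orb i [mod + u ]) k%n≡r reduce))
                                 (Equivalence.to InProg⇔≡mod u∣aₖ))))
    from : n ℕ∣.∣ k → InProg t u (orb k)
    from n∣k = Equivalence.from InProg⇔≡mod (mod-trans reduce
      (subst (λ i → orb i ≡ t [mod + u ]) (sym (ℕ∣.n∣m⇒m%n≡0 k n n∣k)) (mod-refl t)))

  inUnion? : ∀ {k} (us : Vec ℕ k) → Decidable (InUnion t us)
  inUnion? []       x = no λ ()
  inUnion? (u ∷ us) x = (u ℕ∣.∣? ∣ x ℤ.- t ∣) ⊎-dec inUnion? us x

  primitiveDivisors : ∀ {k} {as : Vec ℕ k} → All (InS f t) as →
                      Σ (Vec ℕ k) λ us → AllPositive us × (∀ j → InUnion t us (orb j) ⇔ Any (ℕ∣._∣ j) as)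
  primitiveDivisors [] = [] , _ , λ j → mk⇔ (λ ()) (λ ())
  primitiveDivisors {as = a ∷ _} ((s≤s z≤n , u , pd@(u≥2 , _)) ∷ rest) with primitiveDivisors rest
  ... | us , us-positive , us-divisors =
    u ∷ us , (ℕₚ.≤-trans (s≤s z≤n) u≥2 , us-positive) , λ j →
      ⇔-trans (primitiveDivisor-∣⇔ pd j ⊎-⇔ us-divisors j) (mk⇔ Any.fromSum Any.toSum)

module WanderingOrbit {d} (f : IntPoly d) (t : ℤ) (wandering : Wandering f t) where
  open Orbit f t

  repetition⇒trapped : ∀ {a b} → a < b → orb a ≡ orb b → ∀ k → orb k ∈ List.applyUpTo orb b
  repetition⇒trapped {a} {b} a<b orb-a≡orb-b = <-rec _ trapped
    where
    trapped : ∀ k → (∀ {j} → j < k → orb j ∈ List.applyUpTo orb b) → orb k ∈ List.applyUpTo orb b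
    trapped k rec with k ℕ.<? b
    ... | yes k<b = ∈-applyUpTo⁺ orb k<b
    ... | no  k≮b = subst (_∈ List.applyUpTo orb b) orb-back (rec (subst (k ℕ.∸ b ℕ.+ a <_) k∸b+b≡k
                                                              (ℕₚ.+-monoʳ-< (k ℕ.∸ b) a<b)))
      where
      k∸b+b≡k : k ℕ.∸ b ℕ.+ b ≡ k
      k∸b+b≡k = ℕₚ.m∸n+n≡m (ℕₚ.≮⇒≥ k≮b)
      orb-back : orb (k ℕ.∸ b ℕ.+ a) ≡ orb k
      orb-back = begin
        orb (k ℕ.∸ b ℕ.+ a)           ≡⟨ iter-+ f (k ℕ.∸ b) a t ⟩
        iter f (k ℕ.∸ b) (orb a)      ≡⟨ cong (iter f (k ℕ.∸ b)) orb-a≡orb-b ⟩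
        iter f (k ℕ.∸ b) (orb b)      ≡⟨ iter-+ f (k ℕ.∸ b) b t ⟨
        orb (k ℕ.∸ b ℕ.+ b)           ≡⟨ cong orb k∸b+b≡k ⟩
        orb k                         ∎
        where open ≡-Reasoning

  orb-injective : ∀ {a b} → orb a ≡ orb b → a ≡ b
  orb-injective {a} {b} eq with ℕₚ.<-cmp a b
  ... | tri< a<b _ _ = ⊥-elim (wandering (_ , λ x (k , orbₖ≡x) →
                         subst (_∈ _) orbₖ≡x (repetition⇒trapped a<b eq k)))
  ... | tri≈ _ a≡b _ = a≡b
  ... | tri> _ _ b<a = ⊥-elim (wandering (_ , λ x (k , orbₖ≡x) →
                         subst (_∈ _) orbₖ≡x (repetition⇒trapped b<a (sym eq) k)))

module OrbitDensity {e} (f : IntPoly (suc (suc e))) (t : ℤ) (wandering : Wandering f t) where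
  open Orbit f t
  open WanderingOrbit f t wandering

  private
    B = proj₁ (eval-expanding f)
    expanding = proj₂ (eval-expanding f)
    escape = injective⇒unbounded orb orb-injective B
    k₀ = proj₁ escape

  stays-large : ∀ j → B ≤ ∣ orb (j ℕ.+ k₀) ∣
  stays-large zero    = proj₂ escape
  stays-large (suc j) = ℕₚ.<⇒≤ (ℕₚ.≤-<-trans (stays-large j) (expanding (orb (j ℕ.+ k₀)) (stays-large j)))

  increasing : ∀ k → k₀ ≤ k → ∣ orb k ∣ < ∣ orb (suc k) ∣
  increasing k k₀≤k = expanding (orb k) (subst (λ i → B ≤ ∣ orb i ∣) (ℕₚ.m∸n+n≡m k₀≤k) (stays-large (k ℕ.∸ k₀)))

  open EventuallyIncreasing (∣_∣ ∘ orb) k₀ increasing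

  module Ball {X K} (segment : ∀ k → ∣ orb k ∣ ≤ X ⇔ k < K) where

    ball : List ℤ
    ball = List.applyUpTo orb K

    ball-unique : Unique ball
    ball-unique = applyUpTo⁺₁ orb K (λ i<j _ orbᵢ≡orbⱼ → ℕₚ.<⇒≢ i<j (orb-injective orbᵢ≡orbⱼ))

    ∈-ball⁻ : ∀ x → x ∈ ball → InOrb f t x × ∣ x ∣ ≤ X
    ∈-ball⁻ x x∈ball with ∈-applyUpTo⁻ orb x∈ball
    ... | k , k<K , refl = (k , refl) , Equivalence.from (segment k) k<K

    ∈-ball⁺ : ∀ x → InOrb f t x × ∣ x ∣ ≤ X → x ∈ ball
    ∈-ball⁺ x ((k , refl) , small) = ∈-applyUpTo⁺ orb (Equivalence.to (segment k) small)

    ball-count : HasCount (λ x → InOrb f t x × ∣ x ∣ ≤ X) K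
    ball-count = ball , ball-unique , ∈-ball⁻ , ∈-ball⁺ , List.length-applyUpTo orb K

    ball-count-∩ : ∀ {A} (A? : Decidable A) →
                   HasCount (λ x → A x × InOrb f t x × ∣ x ∣ ≤ X) (count (λ j → does (A? (orb j))) K)
    ball-count-∩ A? = List.filter A? ball , filter⁺ A? ball-unique
      , (λ x x∈ → let x∈ball , Ax = ∈-filter⁻ A? x∈ in Ax , ∈-ball⁻ x x∈ball)
      , (λ x (Ax , x∈) → ∈-filter⁺ A? (∈-ball⁺ x x∈) Ax)
      , length-filter-applyUpTo A? orb K

  -- The orbit points in |x| ≤ X are f^k(t), k < K, with K > Kmin once X is large; then the
  -- ratio of counts is within L/K of the frequency over one period.
  density-periodic : ∀ {A} (A? : Decidable A) L .{{_ : ℕ.NonZero L}} →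
                     (∀ j → does (A? (orb (L ℕ.+ j))) ≡ does (A? (orb j))) →
                     DensityEq f t A (frac (+ count (λ j → does (A? (orb j))) L) (+ L))
  density-periodic     A? zero      _        = ⊥-elim (ℕ.≢-nonZero⁻¹ 0 refl)
  density-periodic {A} A? L@(suc l) periodic ε ε>0 = maxBelow (suc (k₀ ⊔ Kmin)) , window
    where
    Kmin = L ℕ.* ℚ.↧ₙ ε
    hits : ℕ → Bool
    hits j = does (A? (orb j))
    Estimate : ℕ → Set
    Estimate X = Σ ℕ λ N → Σ ℕ λ M →
      HasCount (λ x → A x × InOrb f t x × ∣ x ∣ ≤ X) N × HasCount (λ x → InOrb f t x × ∣ x ∣ ≤ X) M ×
      (M ≢ 0) × (ℚ.∣ frac (+ N) (+ M) ℚ.- frac (+ count hits L) (+ L) ∣ ℚ.< ε)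
    estimate : ∀ {X} → ∃ (λ K → Kmin < K × (∀ k → ∣ orb k ∣ ≤ X ⇔ k < K)) → Estimate X
    estimate (zero  , ()     , _)
    estimate (suc k , Kmin<K , segment) =
      count hits (suc k) , suc k , Ball.ball-count-∩ segment A? , Ball.ball-count segment , (λ ()) ,
      frac-close (count hits (suc k)) (count hits L) k l (count-periodic-error L periodic (suc k)) ε ε>0 Kmin<K
    window : ∀ X → maxBelow (suc (k₀ ⊔ Kmin)) ≤ X → Estimate X
    window X X-large = estimate (initialSegment Kmin X X-large)

  accessible-divisibility : ∀ {k} {as : Vec ℕ k} → All (InS f t) as → ∀ L .{{_ : ℕ.NonZero L}} → All (ℕ∣._∣ L) as →
                            Accessible f t k (frac (+ count (λ j → does (any? (ℕ∣._∣? j) as)) L) (+ L))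
  accessible-divisibility {as = as} as∈S L as∣L with primitiveDivisors as∈S
  ... | us , us-positive , us-divisors = us , us-positive ,
    subst (λ c → DensityEq f t (InUnion t us) (frac (+ c) (+ L)))
          (count-cong (λ j → does-⇔ (us-divisors j) (inUnion? us (orb j)) (any? (ℕ∣._∣? j) as)) L)
          (density-periodic (inUnion? us) L λ j →
            does-⇔ (⇔-trans (us-divisors (L ℕ.+ j)) (⇔-trans (any-∣-periodic as∣L j) (⇔-sym (us-divisors j))))
                   (inUnion? us (orb (L ℕ.+ j))) (inUnion? us (orb j)))

  accessible₂ : ∀ {a b} → InS f t a → InS f t b → Coprime a b →
                ∀ c → c ℕ.+ 1 ≡ a ℕ.+ b → Accessible f t 2 (frac (+ c) (+ (a ℕ.* b)))
  accessible₂ {a@(suc _)} {b@(suc _)} a∈S b∈S a⊥b c c+1≡a+b =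
    subst (λ n → Accessible f t 2 (frac (+ n) (+ (a ℕ.* b)))) count≡c
      (accessible-divisibility (a∈S ∷ b∈S ∷ []) (a ℕ.* b) (ℕ∣.m∣m*n b ∷ ℕ∣.n∣m*n a ∷ []))
    where
    count≡c : count (λ k → a ∣ᵇ k ∨ (b ∣ᵇ k ∨ false)) (a ℕ.* b) ≡ c
    count≡c = ℕₚ.+-cancelʳ-≡ 1 _ c (begin
      count (λ k → a ∣ᵇ k ∨ (b ∣ᵇ k ∨ false)) (a ℕ.* b) ℕ.+ 1
        ≡⟨ cong (ℕ._+ 1) (count-cong (λ k → cong (a ∣ᵇ k ∨_) (Boolₚ.∨-identityʳ (b ∣ᵇ k))) (a ℕ.* b)) ⟩
      count (λ k → a ∣ᵇ k ∨ b ∣ᵇ k) (a ℕ.* b) ℕ.+ 1     ≡⟨ count-∣ᵇ-∨₂ a b a⊥b ⟩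
      b ℕ.+ a                                         ≡⟨ ℕₚ.+-comm b a ⟩
      a ℕ.+ b                                         ≡⟨ c+1≡a+b ⟨
      c ℕ.+ 1                                         ∎)
      where open ≡-Reasoning

  accessible₃ : ∀ {a b c} → InS f t a → InS f t b → InS f t c → Coprime a b → Coprime a c → Coprime b c →
                ∀ X → X ℕ.+ (c ℕ.+ b ℕ.+ a) ≡ b ℕ.* c ℕ.+ a ℕ.* c ℕ.+ a ℕ.* b ℕ.+ 1 →
                Accessible f t 3 (frac (+ X) (+ (a ℕ.* b ℕ.* c)))
  accessible₃ {a@(suc _)} {b@(suc _)} {c@(suc _)} a∈S b∈S c∈S a⊥b a⊥c b⊥c X X≡ =
    subst (λ n → Accessible f t 3 (frac (+ n) (+ L))) count≡X
      (accessible-divisibility (a∈S ∷ b∈S ∷ c∈S ∷ []) L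
        (ℕ∣.∣-trans (ℕ∣.m∣m*n b) (ℕ∣.m∣m*n c) ∷ ℕ∣.∣-trans (ℕ∣.n∣m*n a) (ℕ∣.m∣m*n c) ∷ ℕ∣.n∣m*n (a ℕ.* b) ∷ []))
    where
    L = a ℕ.* b ℕ.* c
    count≡X : count (λ k → a ∣ᵇ k ∨ (b ∣ᵇ k ∨ (c ∣ᵇ k ∨ false))) L ≡ X
    count≡X = ℕₚ.+-cancelʳ-≡ (c ℕ.+ b ℕ.+ a) _ X (begin
      count (λ k → a ∣ᵇ k ∨ (b ∣ᵇ k ∨ (c ∣ᵇ k ∨ false))) L ℕ.+ (c ℕ.+ b ℕ.+ a)
        ≡⟨ cong (ℕ._+ (c ℕ.+ b ℕ.+ a))
                (count-cong (λ k → cong (λ z → a ∣ᵇ k ∨ (b ∣ᵇ k ∨ z)) (Boolₚ.∨-identityʳ (c ∣ᵇ k))) L) ⟩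
      count (λ k → a ∣ᵇ k ∨ (b ∣ᵇ k ∨ c ∣ᵇ k)) L ℕ.+ (c ℕ.+ b ℕ.+ a)  ≡⟨ count-∣ᵇ-∨₃ a b c a⊥b a⊥c b⊥c ⟩
      b ℕ.* c ℕ.+ a ℕ.* c ℕ.+ a ℕ.* b ℕ.+ 1                           ≡⟨ X≡ ⟨
      X ℕ.+ (c ℕ.+ b ℕ.+ a)                                            ∎)
      where open ≡-Reasoning

  accessible-2/n : (n : ℕ) → InSℤ f t (+ n) → InSℤ f t (+ n ℤ.- + 1) → Accessible f t 2 (frac (+ 2) (+ n))
  accessible-2/n n (_ , refl , n∈S) (m , n-1≡m , m∈S@(s≤s z≤n , _)) with +n-+k≡+m⇒n≡k+m n 1 n-1≡m
  ... | refl = subst (Accessible f t 2) (frac-cross (2 ℕ.* m) 2 (suc m ℕ.* m) (suc m) (reduce m))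
    (accessible₂ n∈S m∈S (coprime-1+ ℕ∣.∣-refl) (2 ℕ.* m) (two-consecutive m))
    where
    two-consecutive : ∀ m → 2 ℕ.* m ℕ.+ 1 ≡ suc m ℕ.+ m
    two-consecutive = ℕSolver.solve-∀
    reduce : ∀ m → 2 ℕ.* m ℕ.* suc m ≡ 2 ℕ.* (suc m ℕ.* m)
    reduce = ℕSolver.solve-∀

  accessible-3/n : (n : ℤ) → (∃ λ j → n ≡ + 2 ℤ.* j ℤ.+ + 1) →
                   InSℤ f t n → InSℤ f t (n ℤ.- + 1) → InSℤ f t (n ℤ.- + 2) → Accessible f t 3 (frac (+ 3) n)
  accessible-3/n n (j , n≡2j+1) (a , refl , a∈S) (b , n-1≡b , b∈S) (c , n-2≡c , c∈S@(s≤s z≤n , _))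
    with +n-+k≡+m⇒n≡k+m a 1 n-1≡b
  ... | refl with +n-+k≡+m⇒n≡k+m (suc b) 2 n-2≡c
  ... | refl = subst (Accessible f t 3) (frac-cross (3 ℕ.* suc c ℕ.* c) 3 (suc (suc c) ℕ.* suc c ℕ.* c) (suc (suc c)) (reduce c))
    (accessible₃ a∈S b∈S c∈S (coprime-1+ ℕ∣.∣-refl) (coprime-2+odd (j ℤ.- + 1) c-odd) (coprime-1+ ℕ∣.∣-refl)
                 (3 ℕ.* suc c ℕ.* c) (three-consecutive c))
    where
    c-odd : + c ≡ + 2 ℤ.* (j ℤ.- + 1) ℤ.+ + 1
    c-odd = trans (sym n-2≡c) (trans (cong (ℤ._- + 2) n≡2j+1) (shift j))
      where
      shift : ∀ j → + 2 ℤ.* j ℤ.+ + 1 ℤ.- + 2 ≡ + 2 ℤ.* (j ℤ.- + 1) ℤ.+ + 1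
      shift = ℤSolver.solve-∀
    three-consecutive : ∀ c → 3 ℕ.* suc c ℕ.* c ℕ.+ (c ℕ.+ suc c ℕ.+ suc (suc c))
                              ≡ suc c ℕ.* c ℕ.+ suc (suc c) ℕ.* c ℕ.+ suc (suc c) ℕ.* suc c ℕ.+ 1
    three-consecutive = ℕSolver.solve-∀
    reduce : ∀ c → 3 ℕ.* suc c ℕ.* c ℕ.* suc (suc c) ≡ 3 ℕ.* (suc (suc c) ℕ.* suc c ℕ.* c)
    reduce = ℕSolver.solve-∀

  accessible-m/n : (m n : ℤ) → (∃ λ q → (n ℤ.- + 1 ≡ q ℤ.* (m ℤ.- + 1)) × InSℤ f t q) → InSℤ f t n →
                   Accessible f t 2 (frac m n)
  accessible-m/n m n (_ , n-1≡q[m-1] , (q , refl , q∈S@(s≤s z≤n , _))) (_ , refl , n∈S@(s≤s z≤n , _)) =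
    with-quotient m (m ℤ.- + 1) n∈S (m-1+1≡m m) n-1≡q[m-1]
    where
    m-1+1≡m : ∀ m → m ℤ.- + 1 ℤ.+ + 1 ≡ m
    m-1+1≡m = ℤSolver.solve-∀
    quotient-sum : ∀ q r → q ℕ.* suc r ℕ.+ 1 ≡ suc (q ℕ.* r) ℕ.+ q
    quotient-sum = ℕSolver.solve-∀
    reduce : ∀ q r → q ℕ.* suc r ℕ.* suc (q ℕ.* r) ≡ (r ℕ.+ 1) ℕ.* (suc (q ℕ.* r) ℕ.* q)
    reduce = ℕSolver.solve-∀
    -- r stands for m - 1; it cannot be negative because n - 1 = q r ≥ 0.
    with-quotient : ∀ {n} m r → InS f t (suc n) → r ℤ.+ + 1 ≡ m → + suc n ℤ.- + 1 ≡ + q ℤ.* r →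
                    Accessible f t 2 (frac m (+ suc n))
    with-quotient m -[1+ _ ] _   _    ()
    with-quotient m (+ r)    n∈S refl n-1≡qr
      with ℕₚ.suc-injective (+n-+k≡+m⇒n≡k+m (suc _) 1 (trans n-1≡qr (sym (ℤₚ.pos-* q r))))
    ... | refl = subst (Accessible f t 2)
      (frac-cross (q ℕ.* suc r) (r ℕ.+ 1) (suc (q ℕ.* r) ℕ.* q) (suc (q ℕ.* r)) (reduce q r))
      (accessible₂ n∈S q∈S (coprime-1+ (ℕ∣.m∣m*n r)) (q ℕ.* suc r) (quotient-sum q r))

proposition6p5 : ∀ (d : ℕ) (f : IntPoly d) (t : ℤ) → 2 ≤ d → Wandering f t →
    ((n : ℕ) → InSℤ f t (+ n) → InSℤ f t (+ n - + 1) →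
      Accessible f t 2 (frac (+ 2) (+ n)))
  × ((n : ℤ) → (∃ λ j → n ≡ + 2 * j + + 1) → InSℤ f t n → InSℤ f t (n - + 1) → InSℤ f t (n - + 2) →
      Accessible f t 3 (frac (+ 3) n))
  × ((m n : ℤ) → (∃ λ q → (n - + 1 ≡ q * (m - + 1)) × InSℤ f t q) → InSℤ f t n →
      Accessible f t 2 (frac m n))
proposition6p5 (suc (suc _)) f t (s≤s (s≤s z≤n)) wandering = accessible-2/n , accessible-3/n , accessible-m/n
  where open OrbitDensity f t wandering
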